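{- Let $a\in\mathbb{Z}$ and $m,q\in\mathbb{Z}^+$ with $q$ even and $\gcd(m,q)=1$. Then $$\sum_{j=0}^{q-1}(-1)^{j-1}\left(\left\lfloor\frac{a+jm}{q}\right\rfloor+\frac{1-m}{2}\right)=\frac{m-(-1)^a}{2}.$$
   Context: $\lfloor\alpha\rfloor$ denotes the greatest integer not exceeding a real number $\alpha$. -}

module Defs where

open import Data.Nat using (ℕ; zero; suc)
open import Data.Integer using (ℤ; +_; -[1+_])
import Data.Integer.DivMod as ℤDM
open import Data.Rational using (ℚ; 0ℚ; 1ℚ; _+_; -_)

sumℚ : ℕ → (ℕ → ℚ) → ℚ
sumℚ zero    f = 0ℚ
sumℚ (suc n) f = sumℚ n f + f n

negOnePow : ℤ → ℚ
negOnePow k with k ℤDM.% + 2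
... | zero  = 1ℚ
... | suc _ = - 1ℚ

-- Let S(a) = Σ_{j<q} (-1)^(j-1) ⌊(a + j m)/q⌋.  Since q is even the constant terms (1 - m)/2
-- cancel, so the claim is 2 S(a) = m - (-1)^a.  Passing from a to a + 1 raises exactly one floor,
-- at the unique j₀ < q with q ∣ a + 1 + j₀ m, and as q is even and m odd, (-1)^(j₀-1) = (-1)^a;
-- hence S(a + 1) = S(a) + (-1)^a.  Passing from a to a + m shifts the index j by one, which gives
-- S(a + m) = m - S(a).  So D(a) = 2 S(a) + (-1)^a - m is invariant under a ↦ a + 1 but changes
-- sign under a ↦ a + m, forcing D = 0.

module Submission where

open import Defs
open import Data.Nat.Base as ℕ using (ℕ; zero; suc; NonZero; z≤n; s≤s)
import Data.Nat.Properties as ℕ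
import Data.Nat.Divisibility as ℕ
import Data.Nat.DivMod as ℕ
open import Data.Product using (∃-syntax; _×_; _,_)
open import Data.Sum using (inj₁; inj₂)
open import Function using (_∘_)
open import Data.Nat.Coprimality as Coprimality using (Coprime)
open import Relation.Binary.PropositionalEquality
open import Relation.Nullary.Negation using (¬_; contradiction)

module IntegerDivision where

  open import Data.Integer.Base
    using (ℤ; +_; 1ℤ; _+_; _-_; _*_; _≤_; _<_; +<+; _/ℕ_; _%ℕ_) renaming (suc to sucℤ)
  open import Data.Integer.Properties
    using ( <-cmp; ≤-trans; <⇒≱; i<j⇒suc[i]≤j; *-monoʳ-≤-nonNeg; i≤j+i; +-monoˡ-<; suc-*
          ; +-injective; +-0-abelianGroup; +-identityˡ; *-assoc; *-zeroʳ
          ; *-cancelʳ-≤-pos; *-cancelʳ-<-nonNeg)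
  open import Data.Integer.DivMod using (a≡a%ℕn+[a/ℕn]*n; [n/ℕd]*d≤n; n<s[n/ℕd]*d; n%ℕd<d)
  open import Data.Integer.Divisibility.Signed using (_∣_; divides)
  open import Data.Integer.Tactic.RingSolver using (solve-∀)
  open import Algebra.Properties.AbelianGroup +-0-abelianGroup using (∙-cancelʳ)
  open import Relation.Binary.Definitions using (tri<; tri≈; tri>)

  /ℕ-unique-≤ : ∀ {n k} d .{{_ : NonZero d}} → k * + d ≤ n → n < sucℤ k * + d → n /ℕ d ≡ k
  /ℕ-unique-≤ {n} {k} d k*d≤n n<[1+k]*d with <-cmp (n /ℕ d) k
  ... | tri< n/d<k _ _ = contradiction
    (≤-trans (*-monoʳ-≤-nonNeg (+ d) (i<j⇒suc[i]≤j n/d<k)) k*d≤n) (<⇒≱ (n<s[n/ℕd]*d n d))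
  ... | tri≈ _ n/d≡k _ = n/d≡k
  ... | tri> _ _ k<n/d = contradiction
    (≤-trans (*-monoʳ-≤-nonNeg (+ d) (i<j⇒suc[i]≤j k<n/d)) ([n/ℕd]*d≤n n d)) (<⇒≱ n<[1+k]*d)

  /ℕ-unique : ∀ {n r} d k .{{_ : NonZero d}} → r ℕ.< d → n ≡ + r + k * + d → n /ℕ d ≡ k
  /ℕ-unique {r = r} d k r<d refl = /ℕ-unique-≤ d (i≤j+i (k * + d) (+ r))
    (subst (+ r + k * + d <_) (sym (suc-* k (+ d))) (+-monoˡ-< (k * + d) (+<+ r<d)))

  %ℕ-unique : ∀ {n r} d k .{{_ : NonZero d}} → r ℕ.< d → n ≡ + r + k * + d → n %ℕ d ≡ r
  %ℕ-unique {n} {r} d k r<d n≡r+k*d = +-injective (∙-cancelʳ (k * + d) _ _ (begin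
    + (n %ℕ d) + k * + d       ≡⟨ cong (λ k′ → + (n %ℕ d) + k′ * + d) (/ℕ-unique d k r<d n≡r+k*d) ⟨
    + (n %ℕ d) + n /ℕ d * + d  ≡⟨ a≡a%ℕn+[a/ℕn]*n n d ⟨
    n                          ≡⟨ n≡r+k*d ⟩
    + r + k * + d              ∎))
    where open ≡-Reasoning

  private
    n+k*d≡r+[q+k]*d : ∀ n k d .{{_ : NonZero d}} → n + k * + d ≡ + (n %ℕ d) + (n /ℕ d + k) * + d
    n+k*d≡r+[q+k]*d n k d =
      trans (cong (_+ k * + d) (a≡a%ℕn+[a/ℕn]*n n d)) (regroup (+ (n %ℕ d)) (n /ℕ d) k (+ d))
      where
      regroup : ∀ r q k d → r + q * d + k * d ≡ r + (q + k) * d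
      regroup = solve-∀

  [n+k*d]/ℕd≡n/ℕd+k : ∀ n k d .{{_ : NonZero d}} → (n + k * + d) /ℕ d ≡ n /ℕ d + k
  [n+k*d]/ℕd≡n/ℕd+k n k d = /ℕ-unique d (n /ℕ d + k) (n%ℕd<d n d) (n+k*d≡r+[q+k]*d n k d)

  [n+k*d]%ℕd≡n%ℕd : ∀ n k d .{{_ : NonZero d}} → (n + k * + d) %ℕ d ≡ n %ℕ d
  [n+k*d]%ℕd≡n%ℕd n k d = %ℕ-unique d (n /ℕ d + k) (n%ℕd<d n d) (n+k*d≡r+[q+k]*d n k d)

  d∣n+1⇒[n+1]/ℕd≡n/ℕd+1 : ∀ n d .{{_ : NonZero d}} →
                          + d ∣ n + 1ℤ → (n + 1ℤ) /ℕ d ≡ n /ℕ d + 1ℤ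
  d∣n+1⇒[n+1]/ℕd≡n/ℕd+1 n d@(suc d-1) (divides k n+1≡k*d) = begin
    (n + 1ℤ) /ℕ d  ≡⟨ /ℕ-unique d k (s≤s z≤n) (trans n+1≡k*d (sym (+-identityˡ (k * + d)))) ⟩
    k              ≡⟨ k≡[k-1]+1 k ⟩
    k - 1ℤ + 1ℤ    ≡⟨ cong (_+ 1ℤ) (/ℕ-unique d (k - 1ℤ) ℕ.≤-refl n≡[d-1]+[k-1]*d) ⟨
    n /ℕ d + 1ℤ    ∎
    where
    open ≡-Reasoning
    k≡[k-1]+1 : ∀ k → k ≡ k - 1ℤ + 1ℤ
    k≡[k-1]+1 = solve-∀
    n≡n+1-1 : ∀ n → n ≡ n + 1ℤ - 1ℤ
    n≡n+1-1 = solve-∀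
    k*[1+e]-1 : ∀ k e → k * (1ℤ + e) - 1ℤ ≡ e + (k - 1ℤ) * (1ℤ + e)
    k*[1+e]-1 = solve-∀
    n≡[d-1]+[k-1]*d : n ≡ + d-1 + (k - 1ℤ) * + d
    n≡[d-1]+[k-1]*d = trans (n≡n+1-1 n) (trans (cong (_- 1ℤ) n+1≡k*d) (k*[1+e]-1 k (+ d-1)))

  d∤n+1⇒[n+1]/ℕd≡n/ℕd : ∀ n d .{{_ : NonZero d}} →
                        ¬ (+ d ∣ n + 1ℤ) → (n + 1ℤ) /ℕ d ≡ n /ℕ d
  d∤n+1⇒[n+1]/ℕd≡n/ℕd n d@(suc d-1) d∤n+1
    with n %ℕ d | n%ℕd<d n d | a≡a%ℕn+[a/ℕn]*n n d
  ... | r | s≤s r≤d-1 | n≡r+q*d with ℕ.m≤n⇒m<n∨m≡n r≤d-1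
  ...   | inj₁ r<d-1 =
    /ℕ-unique d (n /ℕ d) (s≤s r<d-1) (trans (cong (_+ 1ℤ) n≡r+q*d) (shift-one (+ r) (n /ℕ d) (+ d)))
    where
    shift-one : ∀ r q d → r + q * d + 1ℤ ≡ 1ℤ + r + q * d
    shift-one = solve-∀
  ...   | inj₂ refl =
    contradiction (divides (n /ℕ d + 1ℤ) (trans (cong (_+ 1ℤ) n≡r+q*d) (wrap (+ d-1) (n /ℕ d)))) d∤n+1
    where
    wrap : ∀ r q → r + q * (1ℤ + r) + 1ℤ ≡ (q + 1ℤ) * (1ℤ + r)
    wrap = solve-∀

  *-cancelʳ-/ℕ : ∀ {n n′ d d′ g} .{{_ : NonZero d}} .{{_ : NonZero d′}} →
                 n′ * + g ≡ n → + d′ * + g ≡ + d → n′ /ℕ d′ ≡ n /ℕ d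
  *-cancelʳ-/ℕ {d = d} {d′} {zero} _ d′*0≡d =
    contradiction (+-injective (trans (sym d′*0≡d) (*-zeroʳ (+ d′)))) (ℕ.≢-nonZero⁻¹ d)
  *-cancelʳ-/ℕ {n} {n′} {d} {d′} {g@(suc _)} n′*g≡n d′*g≡d = /ℕ-unique-≤ d′ lower upper
    where
    k = n /ℕ d
    scale : ∀ x → x * + d ≡ x * + d′ * + g
    scale x = trans (cong (x *_) (sym d′*g≡d)) (sym (*-assoc x (+ d′) (+ g)))
    lower : k * + d′ ≤ n′
    lower = *-cancelʳ-≤-pos (k * + d′) n′ (+ g) (subst₂ _≤_ (scale k) (sym n′*g≡n) ([n/ℕd]*d≤n n d))
    upper : n′ < sucℤ k * + d′
    upper = *-cancelʳ-<-nonNeg (+ g) (subst₂ _<_ (sym n′*g≡n) (scale (sucℤ k)) (n<s[n/ℕd]*d n d))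

module IntegerSums where

  open import Data.Integer.Base using (ℤ; 0ℤ; -_; _+_; _*_)
  open import Data.Integer.Properties using (+-comm; +-assoc; *-zeroˡ; *-distribʳ-+; neg-distrib-+)
  open import Data.Integer.Tactic.RingSolver using (solve-∀)

  sumℤ : ℕ → (ℕ → ℤ) → ℤ
  sumℤ zero    g = 0ℤ
  sumℤ (suc n) g = sumℤ n g + g n

  sumℤ-cong : ∀ n {g h : ℕ → ℤ} → (∀ {j} → j ℕ.< n → g j ≡ h j) → sumℤ n g ≡ sumℤ n h
  sumℤ-cong zero    _   = refl
  sumℤ-cong (suc n) g≗h = cong₂ _+_ (sumℤ-cong n (λ j<n → g≗h (ℕ.m<n⇒m<1+n j<n))) (g≗h (ℕ.n<1+n n))

  sumℤ-distrib-+ : ∀ n (g h : ℕ → ℤ) → sumℤ n (λ j → g j + h j) ≡ sumℤ n g + sumℤ n h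
  sumℤ-distrib-+ zero    g h = refl
  sumℤ-distrib-+ (suc n) g h =
    trans (cong (_+ (g n + h n)) (sumℤ-distrib-+ n g h)) (interchange (sumℤ n g) (sumℤ n h) (g n) (h n))
    where
    interchange : ∀ a b c d → a + b + (c + d) ≡ a + c + (b + d)
    interchange = solve-∀

  sumℤ-distribʳ-* : ∀ n (g : ℕ → ℤ) c → sumℤ n (λ j → g j * c) ≡ sumℤ n g * c
  sumℤ-distribʳ-* zero    g c = sym (*-zeroˡ c)
  sumℤ-distribʳ-* (suc n) g c =
    trans (cong (_+ g n * c) (sumℤ-distribʳ-* n g c)) (sym (*-distribʳ-+ c (sumℤ n g) (g n)))

  sumℤ-neg : ∀ n (g : ℕ → ℤ) → sumℤ n (λ j → - g j) ≡ - sumℤ n g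
  sumℤ-neg zero    g = refl
  sumℤ-neg (suc n) g = trans (cong (_+ - g n) (sumℤ-neg n g)) (sym (neg-distrib-+ (sumℤ n g) (g n)))

  sumℤ-shift : ∀ n (g : ℕ → ℤ) → sumℤ (suc n) g ≡ g 0 + sumℤ n (g ∘ suc)
  sumℤ-shift zero    g = +-comm 0ℤ (g 0)
  sumℤ-shift (suc n) g = trans (cong (_+ g (suc n)) (sumℤ-shift n g)) (+-assoc (g 0) _ _)

  sumℤ-update : ∀ n {g h : ℕ → ℤ} {j₀ c} → j₀ ℕ.< n →
                (∀ {j} → j ℕ.< n → j ≢ j₀ → g j ≡ h j) → g j₀ ≡ h j₀ + c →
                sumℤ n g ≡ sumℤ n h + c
  sumℤ-update (suc n) {g} {h} {j₀} {c} j₀<1+n g≗h g[j₀]≡h[j₀]+c with ℕ.m<1+n⇒m<n∨m≡n j₀<1+n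
  ... | inj₁ j₀<n = trans
    (cong₂ _+_ (sumℤ-update n j₀<n (λ j<n → g≗h (ℕ.m<n⇒m<1+n j<n)) g[j₀]≡h[j₀]+c)
               (g≗h (ℕ.n<1+n n) (λ n≡j₀ → ℕ.<-irrefl (sym n≡j₀) j₀<n)))
    (right-comm (sumℤ n h) c (h n))
    where
    right-comm : ∀ a b c → a + b + c ≡ a + c + b
    right-comm = solve-∀
  ... | inj₂ refl = trans
    (cong₂ _+_ (sumℤ-cong n (λ j<n → g≗h (ℕ.m<n⇒m<1+n j<n) (ℕ.<⇒≢ j<n))) g[j₀]≡h[j₀]+c)
    (sym (+-assoc (sumℤ n h) (h n) c))

module MinusOnePower where

  open import Data.Integer.Base using (ℤ; +_; 0ℤ; 1ℤ; -1ℤ; -_; _+_; _-_; _*_; _%ℕ_; _/ℕ_)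
  open import Data.Integer.DivMod using (a≡a%ℕn+[a/ℕn]*n; n%ℕd<d)
  open import Data.Integer.Divisibility.Signed using (_∣_; divides; ∣ᵤ⇒∣)
  open import Data.Integer.Tactic.RingSolver using (solve-∀)
  open IntegerDivision using (%ℕ-unique; [n+k*d]%ℕd≡n%ℕd)
  open import Data.Integer.Properties using (neg-involutive)
  open IntegerSums using (sumℤ)

  private
    ±1 : ℕ → ℤ
    ±1 zero    = 1ℤ
    ±1 (suc _) = -1ℤ

  infix 8 -1^_

  -1^_ : ℤ → ℤ
  -1^ x = ±1 (x %ℕ 2)

  -1^-suc : ∀ x → -1^ (x + 1ℤ) ≡ - -1^ x
  -1^-suc x with x %ℕ 2 | n%ℕd<d x 2 | a≡a%ℕn+[a/ℕn]*n x 2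
  ... | 0 | _ | x≡0+q*2 =
    cong ±1 (%ℕ-unique 2 (x /ℕ 2) (s≤s (s≤s z≤n)) (trans (cong (_+ 1ℤ) x≡0+q*2) (even+1 (x /ℕ 2))))
    where
    even+1 : ∀ q → + 0 + q * + 2 + 1ℤ ≡ + 1 + q * + 2
    even+1 = solve-∀
  ... | 1 | _ | x≡1+q*2 =
    cong ±1 (%ℕ-unique 2 (x /ℕ 2 + 1ℤ) (s≤s z≤n) (trans (cong (_+ 1ℤ) x≡1+q*2) (odd+1 (x /ℕ 2))))
    where
    odd+1 : ∀ q → + 1 + q * + 2 + 1ℤ ≡ + 0 + (q + 1ℤ) * + 2
    odd+1 = solve-∀
  ... | suc (suc _) | s≤s (s≤s ()) | _

  -1^-cong-2∣ : ∀ {x y} → + 2 ∣ x - y → -1^ x ≡ -1^ y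
  -1^-cong-2∣ {x} {y} (divides k x-y≡k*2) =
    cong ±1 (trans (cong (_%ℕ 2) x≡y+k*2) ([n+k*d]%ℕd≡n%ℕd y k 2))
    where
    x≡y+[x-y] : ∀ x y → x ≡ y + (x - y)
    x≡y+[x-y] = solve-∀
    x≡y+k*2 : x ≡ y + k * + 2
    x≡y+k*2 = trans (x≡y+[x-y] x y) (cong (λ z → y + z) x-y≡k*2)

  -1^-+odd : ∀ x {y} → + 2 ∣ 1ℤ + y → -1^ (x + y) ≡ - -1^ x
  -1^-+odd x {y} 2∣1+y = begin
    -1^ (x + y)              ≡⟨ neg-involutive (-1^ (x + y)) ⟨
    - - -1^ (x + y)          ≡⟨ cong -_ (-1^-suc (x + y)) ⟨
    - -1^ (x + y + 1ℤ)       ≡⟨ cong -_ (-1^-cong-2∣ {x + y + 1ℤ} {x} 2∣[x+y+1]-x) ⟩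
    - -1^ x                  ∎
    where
    open ≡-Reasoning
    step : ∀ x y → 1ℤ + y ≡ x + y + 1ℤ - x
    step = solve-∀
    2∣[x+y+1]-x : + 2 ∣ x + y + 1ℤ - x
    2∣[x+y+1]-x = subst (+ 2 ∣_) (step x y) 2∣1+y

  altSign : ℕ → ℤ
  altSign j = -1^ (+ j - 1ℤ)

  altSign-suc : ∀ j → altSign (suc j) ≡ - altSign j
  altSign-suc j = trans (cong -1^_ (reindex (+ j))) (-1^-suc (+ j - 1ℤ))
    where
    reindex : ∀ x → 1ℤ + x - 1ℤ ≡ x - 1ℤ + 1ℤ
    reindex = solve-∀

  altSign-even : ∀ {n} → 2 ℕ.∣ n → altSign n ≡ -1ℤ
  altSign-even {n} 2∣n =
    -1^-cong-2∣ {+ n - 1ℤ} { -1ℤ} (subst (+ 2 ∣_) (n≡[n-1]+1 (+ n)) (∣ᵤ⇒∣ 2∣n))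
    where
    n≡[n-1]+1 : ∀ n → n ≡ n - 1ℤ - -1ℤ
    n≡[n-1]+1 = solve-∀

  sumℤ-altSign : ∀ t → sumℤ (t ℕ.* 2) altSign ≡ 0ℤ
  sumℤ-altSign zero    = refl
  sumℤ-altSign (suc t) = begin
    sumℤ (t ℕ.* 2) altSign + altSign (t ℕ.* 2) + altSign (suc (t ℕ.* 2))
      ≡⟨ cong₂ (λ s a → s + altSign (t ℕ.* 2) + a) (sumℤ-altSign t) (altSign-suc (t ℕ.* 2)) ⟩
    0ℤ + altSign (t ℕ.* 2) + - altSign (t ℕ.* 2)
      ≡⟨ cancel (altSign (t ℕ.* 2)) ⟩
    0ℤ ∎
    where
    open ≡-Reasoning
    cancel : ∀ x → 0ℤ + x + - x ≡ 0ℤ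
    cancel = solve-∀

module LinearCongruence {m q : ℕ} .{{_ : NonZero q}} (m⊥q : Coprime m q) where

  open import Data.Integer.Base using (ℤ; +_; 1ℤ; -_; _+_; _-_; _*_; ∣_∣; _%ℕ_; _/ℕ_)
  open import Data.Integer.Properties
    using ( pos-*; +-injective; neg-distribˡ-*; i-j≡0⇒i≡j; ∣i∣≡0⇒i≡0
          ; [+m]-[+n]≡m⊖n; ∣m⊝n∣≤m⊔n)
  open import Data.Integer.DivMod using (a≡a%ℕn+[a/ℕn]*n; n%ℕd<d)
  open import Data.Integer.Divisibility.Signed using (_∣_; divides; ∣m∣n⇒∣m-n; ∣⇒∣ᵤ)
  open import Data.Integer.Coprimality using (coprime-divisor)
  open import Data.Integer.Tactic.RingSolver using (solve-∀)
  open import Data.Nat.GCD using (module Bézout)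
  open ≡-Reasoning

  private
    lift-Bézout : ∀ a b c d → 1 ℕ.+ a ℕ.* b ≡ c ℕ.* d → 1ℤ + + a * + b ≡ + c * + d
    lift-Bézout a b c d eq =
      trans (cong (λ z → 1ℤ + z) (sym (pos-* a b))) (trans (cong +_ eq) (pos-* c d))

  modular-inverse : ∃[ u ] + q ∣ u * + m - 1ℤ
  modular-inverse with Coprimality.coprime-Bézout m⊥q
  ... | Bézout.+- x y 1+y*q≡x*m = + x , divides (+ y) (begin
    + x * + m - 1ℤ       ≡⟨ cong (_- 1ℤ) (lift-Bézout y q x m 1+y*q≡x*m) ⟨
    1ℤ + + y * + q - 1ℤ  ≡⟨ cancel (+ y * + q) ⟩
    + y * + q            ∎)
    where
    cancel : ∀ z → 1ℤ + z - 1ℤ ≡ z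
    cancel = solve-∀
  ... | Bézout.-+ x y 1+x*m≡y*q = - + x , divides (- + y) (begin
    - + x * + m - 1ℤ     ≡⟨ regroup (+ x) (+ m) ⟩
    - (1ℤ + + x * + m)   ≡⟨ cong -_ (lift-Bézout x m y q 1+x*m≡y*q) ⟩
    - (+ y * + q)        ≡⟨ neg-distribˡ-* (+ y) (+ q) ⟩
    - + y * + q          ∎)
    where
    regroup : ∀ x m → - x * m - 1ℤ ≡ - (1ℤ + x * m)
    regroup = solve-∀

  solution-exists : ∀ c → ∃[ j ] j ℕ.< q × + q ∣ c + + j * + m
  solution-exists c with modular-inverse
  ... | u , divides k u*m-1≡k*q = N %ℕ q , n%ℕd<d N q , divides (- (c * k) - N /ℕ q * + m) (begin
    c + + j * + m                                  ≡⟨ expand c (+ j) (N /ℕ q) (+ q) (+ m) ⟩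
    c + (+ j + N /ℕ q * + q) * + m - N /ℕ q * + q * + m
      ≡⟨ cong (λ n → c + n * + m - N /ℕ q * + q * + m) (a≡a%ℕn+[a/ℕn]*n N q) ⟨
    c + N * + m - N /ℕ q * + q * + m               ≡⟨ factor c u (N /ℕ q) (+ q) (+ m) ⟩
    - (c * (u * + m - 1ℤ)) - N /ℕ q * + m * + q
      ≡⟨ cong (λ z → - (c * z) - N /ℕ q * + m * + q) u*m-1≡k*q ⟩
    - (c * (k * + q)) - N /ℕ q * + m * + q         ≡⟨ collect c k (N /ℕ q) (+ q) (+ m) ⟩
    (- (c * k) - N /ℕ q * + m) * + q               ∎)
    where
    N = - (c * u)
    j = N %ℕ q
    expand : ∀ c j Q q m → c + j * m ≡ c + (j + Q * q) * m - Q * q * m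
    expand = solve-∀
    factor : ∀ c u Q q m → c + - (c * u) * m - Q * q * m ≡ - (c * (u * m - 1ℤ)) - Q * m * q
    factor = solve-∀
    collect : ∀ c k Q q m → - (c * (k * q)) - Q * m * q ≡ (- (c * k) - Q * m) * q
    collect = solve-∀

  solution-unique : ∀ {c j j′} → j ℕ.< q → j′ ℕ.< q →
                    + q ∣ c + + j * + m → + q ∣ c + + j′ * + m → j ≡ j′
  solution-unique {c} {j} {j′} j<q j′<q q∣c+jm q∣c+j′m =
    +-injective (i-j≡0⇒i≡j (+ j) (+ j′) (∣i∣≡0⇒i≡0 (<∧∣⇒≡0 ∣j-j′∣<q q∣j-j′)))
    where
    difference : ∀ c j j′ m → c + j * m - (c + j′ * m) ≡ m * (j - j′)
    difference = solve-∀
    q∣j-j′ : q ℕ.∣ ∣ + j - + j′ ∣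
    q∣j-j′ = coprime-divisor (+ q) (+ m) (+ j - + j′) (Coprimality.sym m⊥q)
      (∣⇒∣ᵤ (subst (+ q ∣_) (difference c (+ j) (+ j′) (+ m)) (∣m∣n⇒∣m-n q∣c+jm q∣c+j′m)))
    ∣j-j′∣<q : ∣ + j - + j′ ∣ ℕ.< q
    ∣j-j′∣<q = subst (ℕ._< q) (cong ∣_∣ (sym ([+m]-[+n]≡m⊖n j j′)))
      (ℕ.≤-<-trans (∣m⊝n∣≤m⊔n j j′) (ℕ.⊔-lub j<q j′<q))
    <∧∣⇒≡0 : ∀ {n} → n ℕ.< q → q ℕ.∣ n → n ≡ 0
    <∧∣⇒≡0 {zero}  _   _   = refl
    <∧∣⇒≡0 {suc _} n<q q∣n = contradiction q∣n (ℕ.>⇒∤ n<q)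

coprime-to-even⇒odd : ∀ {m q} → 2 ℕ.∣ q → Coprime m q → 2 ℕ.∣ suc m
coprime-to-even⇒odd {m} 2∣q m⊥q with m ℕ.% 2 in m%2≡r | ℕ.m%n<n m 2
... | 0           | _            = contradiction (m⊥q (ℕ.m%n≡0⇒n∣m m 2 m%2≡r , 2∣q)) λ ()
... | 1           | _            = ℕ.divides (suc (m ℕ./ 2))
  (cong suc (trans (ℕ.m≡m%n+[m/n]*n m 2) (cong (ℕ._+ m ℕ./ 2 ℕ.* 2) m%2≡r)))
... | suc (suc _) | s≤s (s≤s ())

module AlternatingFloorSum (m q : ℕ) .{{_ : NonZero q}} (q-even : 2 ℕ.∣ q) (m⊥q : Coprime m q) where

  open import Data.Integer.Base using (ℤ; +_; 0ℤ; 1ℤ; -1ℤ; -_; _+_; _-_; _*_; _/ℕ_)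
  open import Data.Integer.Properties
    using (+-identityˡ; +-identityʳ; *-comm; neg-involutive; neg-distribˡ-*; +-inverseʳ; *-cancelˡ-≡)
  open import Data.Integer.Divisibility.Signed using (_∣_; ∣ᵤ⇒∣; ∣-trans; ∣n⇒∣m*n; ∣m∣n⇒∣m-n)
  open import Data.Integer.Tactic.RingSolver using (solve-∀)
  open IntegerDivision using ([n+k*d]/ℕd≡n/ℕd+k; d∣n+1⇒[n+1]/ℕd≡n/ℕd+1; d∤n+1⇒[n+1]/ℕd≡n/ℕd)
  open IntegerSums
  open MinusOnePower
  open LinearCongruence m⊥q
  open ≡-Reasoning

  floorTerm : ℤ → ℕ → ℤ
  floorTerm a j = (a + + j * + m) /ℕ q

  altFloorSum : ℤ → ℤ
  altFloorSum a = sumℤ q (λ j → altSign j * floorTerm a j)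

  private
    m-odd : + 2 ∣ 1ℤ + + m
    m-odd = ∣ᵤ⇒∣ (coprime-to-even⇒odd q-even m⊥q)

  altSign-of-solution : ∀ {a j} → + q ∣ a + 1ℤ + + j * + m → altSign j ≡ -1^ a
  altSign-of-solution {a} {j} q∣a+1+jm = -1^-cong-2∣ {+ j - 1ℤ} {a} (subst (+ 2 ∣_) (parity a (+ j) (+ m))
    (∣m∣n⇒∣m-n (∣n⇒∣m*n (+ j) m-odd) (∣-trans (∣ᵤ⇒∣ q-even) q∣a+1+jm)))
    where
    parity : ∀ a j m → j * (1ℤ + m) - (a + 1ℤ + j * m) ≡ j - 1ℤ - a
    parity = solve-∀

  altFloorSum-suc : ∀ a → altFloorSum (a + 1ℤ) ≡ altFloorSum a + -1^ a
  altFloorSum-suc a = jump-at (solution-exists (a + 1ℤ))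
    where
    reassoc : ∀ a x → a + 1ℤ + x ≡ a + x + 1ℤ
    reassoc = solve-∀
    distrib : ∀ s x → s * (x + 1ℤ) ≡ s * x + s
    distrib = solve-∀
    floorTerm-suc : ∀ j → floorTerm (a + 1ℤ) j ≡ (a + + j * + m + 1ℤ) /ℕ q
    floorTerm-suc j = cong (_/ℕ q) (reassoc a (+ j * + m))
    jump-at : ∃[ j₀ ] j₀ ℕ.< q × + q ∣ a + 1ℤ + + j₀ * + m →
              altFloorSum (a + 1ℤ) ≡ altFloorSum a + -1^ a
    jump-at (j₀ , j₀<q , q∣a+1+j₀m) = begin
      altFloorSum (a + 1ℤ)
        ≡⟨ sumℤ-update q j₀<q unchanged jumps ⟩
      altFloorSum a + altSign j₀
        ≡⟨ cong (λ s → altFloorSum a + s) (altSign-of-solution {a} {j₀} q∣a+1+j₀m) ⟩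
      altFloorSum a + -1^ a
        ∎
      where
      unchanged : ∀ {j} → j ℕ.< q → j ≢ j₀ →
                  altSign j * floorTerm (a + 1ℤ) j ≡ altSign j * floorTerm a j
      unchanged {j} j<q j≢j₀ = cong (altSign j *_) (trans (floorTerm-suc j)
        (d∤n+1⇒[n+1]/ℕd≡n/ℕd (a + + j * + m) q λ q∣a+jm+1 → j≢j₀ (solution-unique {a + 1ℤ}
          j<q j₀<q (subst (+ q ∣_) (sym (reassoc a _)) q∣a+jm+1) q∣a+1+j₀m)))
      jumps : altSign j₀ * floorTerm (a + 1ℤ) j₀ ≡ altSign j₀ * floorTerm a j₀ + altSign j₀
      jumps = trans (cong (altSign j₀ *_) (trans (floorTerm-suc j₀)
        (d∣n+1⇒[n+1]/ℕd≡n/ℕd+1 (a + + j₀ * + m) q (subst (+ q ∣_) (reassoc a _) q∣a+1+j₀m))))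
        (distrib (altSign j₀) (floorTerm a j₀))

  altFloorSum-+m : ∀ a → altFloorSum (a + + m) ≡ + m - altFloorSum a
  altFloorSum-+m a = begin
    altFloorSum (a + + m)
      ≡⟨ sumℤ-cong q (λ {j} _ → shifted j) ⟩
    sumℤ q (λ j → - G (suc j))
      ≡⟨ sumℤ-neg q (G ∘ suc) ⟩
    - sumℤ q (G ∘ suc)
      ≡⟨ cong -_ unshift ⟩
    - (altFloorSum a + G q - G 0)
      ≡⟨ cong₂ (λ x y → - (altFloorSum a + x - y)) G[q] G[0] ⟩
    - (altFloorSum a + -1ℤ * (a /ℕ q + + m) - -1ℤ * (a /ℕ q))
      ≡⟨ simplify (altFloorSum a) (a /ℕ q) (+ m) ⟩
    + m - altFloorSum a
      ∎
    where
    G : ℕ → ℤ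
    G j = altSign j * floorTerm a j
    absorb : ∀ a j m → a + m + j * m ≡ a + (1ℤ + j) * m
    absorb = solve-∀
    shifted : ∀ j → altSign j * floorTerm (a + + m) j ≡ - G (suc j)
    shifted j = begin
      altSign j * floorTerm (a + + m) j
        ≡⟨ cong₂ _*_ (neg-involutive (altSign j)) (cong (_/ℕ q) (sym (absorb a (+ j) (+ m)))) ⟨
      - - altSign j * floorTerm a (suc j)   ≡⟨ cong (λ s → - s * floorTerm a (suc j)) (altSign-suc j) ⟨
      - altSign (suc j) * floorTerm a (suc j) ≡⟨ neg-distribˡ-* (altSign (suc j)) (floorTerm a (suc j)) ⟨
      - G (suc j)                           ∎
    peel : ∀ x s → s ≡ x + s - x
    peel = solve-∀
    unshift : sumℤ q (G ∘ suc) ≡ altFloorSum a + G q - G 0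
    unshift = trans (peel (G 0) _) (cong (_- G 0) (sym (sumℤ-shift q G)))
    G[q] : G q ≡ -1ℤ * (a /ℕ q + + m)
    G[q] = cong₂ _*_ (altSign-even q-even)
      (trans (cong (λ x → (a + x) /ℕ q) (*-comm (+ q) (+ m))) ([n+k*d]/ℕd≡n/ℕd+k a (+ m) q))
    G[0] : G 0 ≡ -1ℤ * (a /ℕ q)
    G[0] = cong (λ x → -1ℤ * (x /ℕ q)) (+-identityʳ a)
    simplify : ∀ S d m → - (S + -1ℤ * (d + m) - -1ℤ * d) ≡ m - S
    simplify = solve-∀

  defect : ℤ → ℤ
  defect a = altFloorSum a + altFloorSum a + -1^ a - + m

  defect-suc : ∀ a → defect (a + 1ℤ) ≡ defect a
  defect-suc a = trans (cong₂ (λ S s → S + S + s - + m) (altFloorSum-suc a) (-1^-suc a))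
    (cancel (altFloorSum a) (-1^ a) (+ m))
    where
    cancel : ∀ S s m → S + s + (S + s) + - s - m ≡ S + S + s - m
    cancel = solve-∀

  defect-+ℕ : ∀ a n → defect (a + + n) ≡ defect a
  defect-+ℕ a zero    = cong defect (+-identityʳ a)
  defect-+ℕ a (suc n) =
    trans (cong defect (reassoc a (+ n))) (trans (defect-suc (a + + n)) (defect-+ℕ a n))
    where
    reassoc : ∀ a n → a + (1ℤ + n) ≡ a + n + 1ℤ
    reassoc = solve-∀

  defect-+m : ∀ a → defect (a + + m) ≡ - defect a
  defect-+m a = trans (cong₂ (λ S s → S + S + s - + m) (altFloorSum-+m a) (-1^-+odd a m-odd))
    (negate (altFloorSum a) (-1^ a) (+ m))
    where
    negate : ∀ S s m → m - S + (m - S) + - s - m ≡ - (S + S + s - m)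
    negate = solve-∀

  defect≡0 : ∀ a → defect a ≡ 0ℤ
  defect≡0 a = *-cancelˡ-≡ (+ 2) (defect a) 0ℤ (begin
    + 2 * defect a          ≡⟨ double (defect a) ⟩
    defect a + defect a     ≡⟨ cong (λ d → defect a + d) (trans (sym (defect-+ℕ a m)) (defect-+m a)) ⟩
    defect a + - defect a   ≡⟨ +-inverseʳ (defect a) ⟩
    0ℤ                      ∎)
    where
    double : ∀ x → + 2 * x ≡ x + x
    double = solve-∀

  altFloorSum-closed : ∀ a →
    sumℤ q (λ j → altSign j * (floorTerm a j * + 2 + (1ℤ - + m))) ≡ + m - -1^ a
  altFloorSum-closed a = begin
    sumℤ q (λ j → altSign j * (floorTerm a j * + 2 + c))
      ≡⟨ sumℤ-cong q (λ {j} _ → expand (altSign j) (floorTerm a j) c) ⟩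
    sumℤ q (λ j → altSign j * floorTerm a j * + 2 + altSign j * c)
      ≡⟨ sumℤ-distrib-+ q (λ j → altSign j * floorTerm a j * + 2) (λ j → altSign j * c) ⟩
    sumℤ q (λ j → altSign j * floorTerm a j * + 2) + sumℤ q (λ j → altSign j * c)
      ≡⟨ cong₂ _+_ (sumℤ-distribʳ-* q (λ j → altSign j * floorTerm a j) (+ 2))
                   (sumℤ-distribʳ-* q altSign c) ⟩
    altFloorSum a * + 2 + sumℤ q altSign * c
      ≡⟨ cong (λ s → altFloorSum a * + 2 + s * c) (sum-altSign q-even) ⟩
    altFloorSum a * + 2 + 0ℤ * c
      ≡⟨ rearrange (altFloorSum a) (-1^ a) (+ m) c ⟩
    defect a + (+ m - -1^ a)
      ≡⟨ cong (λ d → d + (+ m - -1^ a)) (defect≡0 a) ⟩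
    0ℤ + (+ m - -1^ a)
      ≡⟨ +-identityˡ (+ m - -1^ a) ⟩
    + m - -1^ a
      ∎
    where
    c = 1ℤ - + m
    expand : ∀ s x c → s * (x * + 2 + c) ≡ s * x * + 2 + s * c
    expand = solve-∀
    rearrange : ∀ S s m c → S * + 2 + 0ℤ * c ≡ S + S + s - m + (m - s)
    rearrange = solve-∀
    sum-altSign : 2 ℕ.∣ q → sumℤ q altSign ≡ 0ℤ
    sum-altSign (ℕ.divides t q≡t*2) = trans (cong (λ n → sumℤ n altSign) q≡t*2) (sumℤ-altSign t)

open import Data.Nat.Divisibility using (_∣_)
open import Data.Nat.GCD using (gcd)
open import Data.Nat.Coprimality using (gcd≡1⇒coprime)
open import Data.Integer using (ℤ; +_; +0; +[1+_]; -[1+_])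
import Data.Integer as ℤ
open import Data.Integer.DivMod using (div-pos-is-/ℕ)
open import Data.Integer.Tactic.RingSolver using (solve-∀)
open import Data.Rational using (ℚ; mkℚ; _/_; floor; _+_; _-_; _*_; -_; ½; 1ℚ; ↥_; ↧ₙ_; toℚᵘ)
open import Data.Rational.Properties
  using ( ↥-/; ↧-/; toℚᵘ-injective; toℚᵘ-fromℚᵘ; toℚᵘ-homo-+; toℚᵘ-homo-*
        ; +-0-group; *-zeroˡ; *-assoc; *-distribʳ-+; *-identityʳ)
open import Algebra.Properties.Group +-0-group using (⁻¹-involutive)
open import Data.Rational.Unnormalised as ℚᵘ using (mkℚᵘ; *≡*) renaming (_≃_ to _≃ᵘ_)
import Data.Rational.Unnormalised.Properties as ℚᵘ
open IntegerDivision using (*-cancelʳ-/ℕ)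
open IntegerSums using (sumℤ)
open MinusOnePower using (-1^_; altSign)

ι : ℤ → ℚ
ι x = x / 1

floor≡↥/ℕ↧ₙ : ∀ p → floor p ≡ ↥ p ℤ./ℕ ↧ₙ p
floor≡↥/ℕ↧ₙ (mkℚ n d-1 _) = div-pos-is-/ℕ n (suc d-1)

floor-/ : ∀ n d .{{_ : NonZero d}} → floor (n / d) ≡ n ℤ./ℕ d
floor-/ n d = trans (floor≡↥/ℕ↧ₙ (n / d))
  (*-cancelʳ-/ℕ {n′ = ↥ (n / d)} {d′ = ↧ₙ (n / d)} {g = gcd ℤ.∣ n ∣ d} (↥-/ n d) (↧-/ n d))

toℚᵘ-/ : ∀ x d → toℚᵘ (x / suc d) ≃ᵘ mkℚᵘ x d
toℚᵘ-/ x d = toℚᵘ-fromℚᵘ (mkℚᵘ x d)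

ι-homo-+ : ∀ x y → ι (x ℤ.+ y) ≡ ι x + ι y
ι-homo-+ x y = toℚᵘ-injective (begin
  toℚᵘ (ι (x ℤ.+ y))          ≈⟨ toℚᵘ-/ (x ℤ.+ y) 0 ⟩
  mkℚᵘ (x ℤ.+ y) 0            ≈⟨ *≡* (sum-over-1 x y) ⟩
  mkℚᵘ x 0 ℚᵘ.+ mkℚᵘ y 0      ≈⟨ ℚᵘ.+-cong (toℚᵘ-/ x 0) (toℚᵘ-/ y 0) ⟨
  toℚᵘ (ι x) ℚᵘ.+ toℚᵘ (ι y)  ≈⟨ toℚᵘ-homo-+ (ι x) (ι y) ⟨
  toℚᵘ (ι x + ι y)            ∎)
  where
  open ℚᵘ.≃-Reasoning
  sum-over-1 : ∀ x y → (x ℤ.+ y) ℤ.* + 1 ≡ (x ℤ.* + 1 ℤ.+ y ℤ.* + 1) ℤ.* + 1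
  sum-over-1 = solve-∀

ι-homo-* : ∀ x y → ι (x ℤ.* y) ≡ ι x * ι y
ι-homo-* x y = toℚᵘ-injective (begin
  toℚᵘ (ι (x ℤ.* y))          ≈⟨ toℚᵘ-/ (x ℤ.* y) 0 ⟩
  mkℚᵘ (x ℤ.* y) 0            ≈⟨ *≡* refl ⟩
  mkℚᵘ x 0 ℚᵘ.* mkℚᵘ y 0      ≈⟨ ℚᵘ.*-cong (toℚᵘ-/ x 0) (toℚᵘ-/ y 0) ⟨
  toℚᵘ (ι x) ℚᵘ.* toℚᵘ (ι y)  ≈⟨ toℚᵘ-homo-* (ι x) (ι y) ⟨
  toℚᵘ (ι x * ι y)            ∎)
  where open ℚᵘ.≃-Reasoning

ι-homo‿- : ∀ x → ι (ℤ.- x) ≡ - ι x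
ι-homo‿- +0         = refl
ι-homo‿- +[1+ n ]   = refl
ι-homo‿- -[1+ n ]   = sym (⁻¹-involutive (ι +[1+ n ]))

ι-homo-minus : ∀ x y → ι (x ℤ.- y) ≡ ι x - ι y
ι-homo-minus x y = trans (ι-homo-+ x (ℤ.- y)) (cong (λ z → ι x + z) (ι-homo‿- y))

/2≡ι*½ : ∀ x → x / 2 ≡ ι x * ½
/2≡ι*½ x = toℚᵘ-injective (begin
  toℚᵘ (x / 2)                ≈⟨ toℚᵘ-/ x 1 ⟩
  mkℚᵘ x 1                    ≈⟨ *≡* (half x) ⟩
  mkℚᵘ x 0 ℚᵘ.* toℚᵘ ½        ≈⟨ ℚᵘ.*-congʳ (toℚᵘ-/ x 0) ⟨
  toℚᵘ (ι x) ℚᵘ.* toℚᵘ ½      ≈⟨ toℚᵘ-homo-* (ι x) ½ ⟨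
  toℚᵘ (ι x * ½)              ∎)
  where
  open ℚᵘ.≃-Reasoning
  half : ∀ x → x ℤ.* + 2 ≡ x ℤ.* + 1 ℤ.* + 2
  half = solve-∀

negOnePow≡ι-1^ : ∀ k → negOnePow k ≡ ι (-1^ k)
negOnePow≡ι-1^ k with k ℤ.%ℕ 2
... | zero  = refl
... | suc _ = refl

ι[2]*½≡1 : ι (+ 2) * ½ ≡ 1ℚ
ι[2]*½≡1 = refl

ι-combine-½ : ∀ s x c → ι s * (ι x + ι c * ½) ≡ ι (s ℤ.* (x ℤ.* + 2 ℤ.+ c)) * ½
ι-combine-½ s x c = sym (begin
  ι (s ℤ.* (x ℤ.* + 2 ℤ.+ c)) * ½        ≡⟨ cong (_* ½) (ι-homo-* s (x ℤ.* + 2 ℤ.+ c)) ⟩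
  ι s * ι (x ℤ.* + 2 ℤ.+ c) * ½          ≡⟨ cong (λ z → ι s * z * ½) (ι-homo-+ (x ℤ.* + 2) c) ⟩
  ι s * (ι (x ℤ.* + 2) + ι c) * ½        ≡⟨ cong (λ z → ι s * (z + ι c) * ½) (ι-homo-* x (+ 2)) ⟩
  ι s * (ι x * ι (+ 2) + ι c) * ½        ≡⟨ *-assoc (ι s) (ι x * ι (+ 2) + ι c) ½ ⟩
  ι s * ((ι x * ι (+ 2) + ι c) * ½)      ≡⟨ cong (ι s *_) (*-distribʳ-+ ½ (ι x * ι (+ 2)) (ι c)) ⟩
  ι s * (ι x * ι (+ 2) * ½ + ι c * ½)    ≡⟨ cong (λ z → ι s * (z + ι c * ½)) (*-assoc (ι x) _ ½) ⟩
  ι s * (ι x * (ι (+ 2) * ½) + ι c * ½)  ≡⟨ cong (λ h → ι s * (ι x * h + ι c * ½)) ι[2]*½≡1 ⟩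
  ι s * (ι x * 1ℚ + ι c * ½)             ≡⟨ cong (λ z → ι s * (z + ι c * ½)) (*-identityʳ (ι x)) ⟩
  ι s * (ι x + ι c * ½)                  ∎)
  where open ≡-Reasoning

sumℚ-ι-*ʳ : ∀ n {f : ℕ → ℚ} (g : ℕ → ℤ) {c} →
            (∀ j → f j ≡ ι (g j) * c) → sumℚ n f ≡ ι (sumℤ n g) * c
sumℚ-ι-*ʳ zero    g {c} _  = sym (*-zeroˡ c)
sumℚ-ι-*ʳ (suc n) g {c} f≗ = begin
  sumℚ n _ + _                        ≡⟨ cong₂ _+_ (sumℚ-ι-*ʳ n g f≗) (f≗ n) ⟩
  ι (sumℤ n g) * c + ι (g n) * c      ≡⟨ *-distribʳ-+ c (ι (sumℤ n g)) (ι (g n)) ⟨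
  (ι (sumℤ n g) + ι (g n)) * c        ≡⟨ cong (_* c) (ι-homo-+ (sumℤ n g) (g n)) ⟨
  ι (sumℤ n g ℤ.+ g n) * c            ∎
  where open ≡-Reasoning

lemma2p3 : (a : ℤ) (m q : ℕ) → .{{_ : NonZero m}} → .{{_ : NonZero q}} →
    2 ∣ q → gcd m q ≡ 1 →
    sumℚ q (λ j → negOnePow (+ j ℤ.- + 1) *
        ((floor ((a ℤ.+ + j ℤ.* + m) / q) / 1) + ((+ 1 ℤ.- + m) / 2)))
      ≡ ((+ m / 1) - negOnePow a) * ½
lemma2p3 a m q q-even gcd≡1 = begin
  sumℚ q _                         ≡⟨ sumℚ-ι-*ʳ q u term ⟩
  ι (sumℤ q u) * ½                 ≡⟨ cong (λ z → ι z * ½) (altFloorSum-closed a) ⟩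
  ι (+ m ℤ.- -1^ a) * ½            ≡⟨ cong (_* ½) (ι-homo-minus (+ m) (-1^ a)) ⟩
  (ι (+ m) - ι (-1^ a)) * ½        ≡⟨ cong (λ z → (ι (+ m) - z) * ½) (negOnePow≡ι-1^ a) ⟨
  (ι (+ m) - negOnePow a) * ½      ∎
  where
  open ≡-Reasoning
  open AlternatingFloorSum m q q-even (gcd≡1⇒coprime gcd≡1)
  u : ℕ → ℤ
  u j = altSign j ℤ.* (floorTerm a j ℤ.* + 2 ℤ.+ (+ 1 ℤ.- + m))
  term : ∀ j → negOnePow (+ j ℤ.- + 1) * ((floor ((a ℤ.+ + j ℤ.* + m) / q) / 1) + ((+ 1 ℤ.- + m) / 2))
             ≡ ι (u j) * ½
  term j = trans
    (cong₂ _*_ (negOnePow≡ι-1^ (+ j ℤ.- + 1))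
      (cong₂ _+_ (cong ι (floor-/ (a ℤ.+ + j ℤ.* + m) q)) (/2≡ι*½ (+ 1 ℤ.- + m))))
    (ι-combine-½ (altSign j) (floorTerm a j) (+ 1 ℤ.- + m))
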